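{- Let $H$ be a fixed connected graph with $c>1$ vertices, let $G=(V,E)$ be a graph with degeneracy $d$, and let $G'$ be the graph output by Construction 3 (described below). Then $G$ contains a subgraph $F=(V_F,E_F)$ isomorphic to $H$ if and only if $G'$ contains a subgraph $F'=(V_F',E_F')$ isomorphic to $H$, where $V_F'$ and $E_F'$ are copies in $G'$ of $V_F$ and $E_F$, respectively.
   Context: The degeneracy of a graph is the smallest $d$ such that every induced subgraph has a vertex of degree at most $d$; a degeneracy ordering is an ordering $\sigma$ of the vertices in which each vertex $v$ has at most $d$ neighbors ordered after $v$. Construction 3: Compute a degeneracy ordering $\sigma$. If $d\le 4c^2$, set $G'=G$. Otherwise, for each vertex $v$ let $E_v:=\{\{v,w\}\in E:\sigma(v)<\sigma(w)\}$, enumerated as $\{e_1,\dots,e_{|E_v|}\}$, and for $p\in\{1,\dots,4c^2\}$ let $E_v^p:=\{e_i\in E_v: i\bmod 4c^2=p-1\}$; let $E^p:=\bigcup_{v\in V}E_v^p$. Let $G'$ be the disjoint union, over all $c^2$-element sets $\{a_1,\dots,a_{c^2}\}\subseteq\{1,\dots,4c^2\}$, of the graphs $(V,E^{a_1}\cup\dots\cup E^{a_{c^2}})$. Each vertex/edge of $G'$ is thus a copy of a vertex/edge of $G$. -}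

module Defs where

open import Data.Nat as ℕ using (ℕ; _+_; _*_; _≤_)
open import Data.Bool using (Bool; true; false; _∧_)
open import Data.Fin as Fin using (Fin; toℕ)
open import Data.Fin.Subset as Sub using (Subset; ∣_∣; Nonempty)
open import Data.Vec using (tabulate; lookup)
open import Data.Product using (Σ; ∃; _×_; _,_; proj₂)
open import Data.Sum using (_⊎_)
open import Relation.Binary.PropositionalEquality using (_≡_)
open import Relation.Binary.Construct.Closure.ReflexiveTransitive using (Star)
open import Relation.Nullary.Decidable using (⌊_⌋)
open import Relation.Nullary using (yes; no)
open import Function using (id; _∘_)
open import Function.Definitions using (Injective)

record Graph (n : ℕ) : Set where
  field
    adj    : Fin n → Fin n → Bool
    sym    : ∀ u v → adj u v ≡ adj v u
    irrefl : ∀ v → adj v v ≡ false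
open Graph public

Edge : ∀ {n} → Graph n → Fin n → Fin n → Set
Edge G u v = adj G u v ≡ true

Connected : ∀ {n} → Graph n → Set
Connected G = ∀ i j → Star (Edge G) i j

degIn : ∀ {n} → Graph n → Subset n → Fin n → ℕ
degIn G U v = ∣ tabulate (λ w → adj G v w ∧ lookup U w) ∣

EveryInducedHasDegLe : ∀ {n} → Graph n → ℕ → Set
EveryInducedHasDegLe G d =
  ∀ U → Nonempty U → ∃ λ v → v Sub.∈ U × degIn G U v ≤ d

IsDegeneracy : ∀ {n} → Graph n → ℕ → Set
IsDegeneracy G d = EveryInducedHasDegLe G d × (∀ d' → EveryInducedHasDegLe G d' → d ≤ d')

-- an ordering σ of the vertices (σ v = position of v; a bijection Fin n → Fin n)
-- w is a neighbour of v ordered after v, i.e. {v,w} ∈ E_v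
Later : ∀ {n} → Graph n → (Fin n → Fin n) → Fin n → Fin n → Set
Later G σ v w = Edge G v w × σ v Fin.< σ w

laterSet : ∀ {n} → Graph n → (Fin n → Fin n) → Fin n → Subset n
laterSet G σ v = tabulate (λ w → adj G v w ∧ ⌊ σ v Fin.<? σ w ⌋)

laterCount : ∀ {n} → Graph n → (Fin n → Fin n) → Fin n → ℕ
laterCount G σ v = ∣ laterSet G σ v ∣

IsDegeneracyOrdering : ∀ {n} → Graph n → ℕ → (Fin n → Fin n) → Set
IsDegeneracyOrdering G d σ = Injective _≡_ _≡_ σ × (∀ v → laterCount G σ v ≤ d)

-- idx v w = i - 1 where {v,w} = e_i in the enumeration of E_v:
-- idx v restricted to E_v is a bijection onto {0, …, |E_v| - 1}.
IsEnumeration : ∀ {n} → Graph n → (Fin n → Fin n) → (Fin n → Fin n → ℕ) → Set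
IsEnumeration G σ idx = ∀ v →
  (∀ w → Later G σ v w → idx v w ℕ.< laterCount G σ v) ×
  (∀ w w' → Later G σ v w → Later G σ v w' → idx v w ≡ idx v w' → w ≡ w')

-- i mod K = toℕ p   (p : Fin K encodes the class p+1 ∈ {1,…,K})
ModIs : (K i : ℕ) → Fin K → Set
ModIs K i p = ∃ λ q → i ≡ q * K + toℕ p

-- {v,w} ∈ E^{p+1}: it lies in E_v^{p+1} or in E_w^{p+1} (index i = idx + 1)
InClass : ∀ {n} (K : ℕ) → (Fin n → Fin n) → (Fin n → Fin n → ℕ) → Fin n → Fin n → Fin K → Set
InClass K σ idx v w p =
  (σ v Fin.< σ w × ModIs K (idx v w + 1) p) ⊎ (σ w Fin.< σ v × ModIs K (idx w v + 1) p)

record CopyGraph (n : ℕ) : Set₁ where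
  field
    V'   : Set
    adj' : V' → V' → Set
    copy : V' → Fin n
open CopyGraph public

construction3 : ∀ {n} (c : ℕ) → Graph n → (d : ℕ) → (Fin n → Fin n) → (Fin n → Fin n → ℕ) → CopyGraph n
construction3 {n} c G d σ idx with d ℕ.≤? 4 * c * c
... | yes _ = record { V' = Fin n ; adj' = Edge G ; copy = id }
... | no _ = record
  { V'   = (Σ (Subset K) (λ S → ∣ S ∣ ≡ c * c)) × Fin n
  ; adj' = λ { ((S , _) , v) ((S' , _) , w) →
               S ≡ S' × Edge G v w × (∃ λ p → p Sub.∈ S × InClass K σ idx v w p) }
  ; copy = proj₂
  }
  where K = 4 * c * c

-- f embeds H as a (not necessarily induced) subgraph of G
IsEmbedding : ∀ {c n} → Graph c → Graph n → (Fin c → Fin n) → Set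
IsEmbedding H G f = Injective _≡_ _≡_ f × (∀ i j → Edge H i j → Edge G (f i) (f j))

IsEmbedding' : ∀ {c n} → Graph c → (G' : CopyGraph n) → (Fin c → V' G') → Set
IsEmbedding' H G' f = Injective _≡_ _≡_ f × (∀ i j → Edge H i j → adj' G' (f i) (f j))

module Submission where

-- If d ≤ 4c², then G' = G and there is nothing to prove.
-- Otherwise G' is the disjoint union of copies G_S of G, one for every
-- c²-element set S of the 4c² edge classes, where G_S keeps exactly the edges
-- whose class lies in S.
--
--  * (⇒) An embedding f of H into G uses at most c² edges {f i, f j}, hence at
--    most c² classes.  Enlarging this set of classes to a c²-element set S,
--    every edge f i f j survives in G_S, so i ↦ (S , f i) embeds H into G'.
--  * (⇐) Adjacent vertices of G' lie in the same copy G_S and project to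
--    adjacent vertices of G.  Since H is connected, an embedding of H into G'
--    lands in a single copy, on which the projection is injective; so the
--    projected map is again an embedding.

open import Defs
open import Data.Nat using (ℕ; _<_)
open import Data.Fin using (Fin)
open import Data.Product using (Σ; _×_)
open import Relation.Binary.PropositionalEquality using (_≡_)
open import Function using (_∘_)

open import Data.Nat as ℕ using (zero; suc; s≤s; _≤_; _%_; _/_; NonZero)
import Data.Nat.Properties as ℕP
open import Data.Nat.DivMod using (m≡m%n+[m/n]*n; m%n<n)
open import Data.Fin as Fin using (zero; suc; toℕ; fromℕ<; combine; remQuot)
import Data.Fin.Properties as FinP
open import Data.Fin.Subset as Sub using (Subset; ∣_∣; ⊥; _⊆_; _∈_; inside; outside)
open import Data.Fin.Subset.Properties using (∣⊥∣≡0; ∣p∣≤n)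
open import Data.Vec using (_∷_; []; here; there)
open import Data.Product using (_,_; proj₁; proj₂; ∃)
open import Data.Sum using (inj₁; inj₂)
open import Data.Empty using (⊥-elim) renaming (⊥ to False)
open import Relation.Binary using (tri<; tri≈; tri>)
open import Relation.Binary.PropositionalEquality
  using (refl; trans; cong; subst; module ≡-Reasoning) renaming (sym to ≡-sym)
open import Relation.Binary.Construct.Closure.ReflexiveTransitive using (Star; ε; _◅_)
open import Relation.Nullary using (yes; no)

insert : ∀ {K} → Fin K → Subset K → Subset K
insert zero    (_ ∷ T) = inside ∷ T
insert (suc x) (b ∷ T) = b ∷ insert x T

∣insert∣≤ : ∀ {K} (x : Fin K) (T : Subset K) → ∣ insert x T ∣ ≤ suc ∣ T ∣
∣insert∣≤ zero    (inside  ∷ T) = ℕP.n≤1+n _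
∣insert∣≤ zero    (outside ∷ T) = ℕP.≤-refl
∣insert∣≤ (suc x) (inside  ∷ T) = s≤s (∣insert∣≤ x T)
∣insert∣≤ (suc x) (outside ∷ T) = ∣insert∣≤ x T

x∈insert : ∀ {K} (x : Fin K) (T : Subset K) → x ∈ insert x T
x∈insert zero    (_ ∷ T) = here
x∈insert (suc x) (_ ∷ T) = there (x∈insert x T)

⊆insert : ∀ {K} (x : Fin K) (T : Subset K) → T ⊆ insert x T
⊆insert zero    (_ ∷ T) here      = here
⊆insert zero    (_ ∷ T) (there y) = there y
⊆insert (suc x) (_ ∷ T) here      = here
⊆insert (suc x) (_ ∷ T) (there y) = there (⊆insert x T y)

image : ∀ {K} (m : ℕ) → (Fin m → Fin K) → Subset K
image zero    g = ⊥
image (suc m) g = insert (g zero) (image m (g ∘ suc))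

∣image∣≤ : ∀ {K} (m : ℕ) (g : Fin m → Fin K) → ∣ image m g ∣ ≤ m
∣image∣≤ {K} zero g = ℕP.≤-reflexive (∣⊥∣≡0 K)
∣image∣≤ (suc m) g =
  ℕP.≤-trans (∣insert∣≤ (g zero) (image m (g ∘ suc))) (s≤s (∣image∣≤ m (g ∘ suc)))

∈image : ∀ {K} (m : ℕ) (g : Fin m → Fin K) (i : Fin m) → g i ∈ image m g
∈image (suc m) g zero    = x∈insert (g zero) _
∈image (suc m) g (suc i) = ⊆insert (g zero) _ (∈image m (g ∘ suc) i)

enlarge : ∀ {K} (T : Subset K) (m : ℕ) → ∣ T ∣ ≤ m → m ≤ K →
          ∃ λ S → T ⊆ S × ∣ S ∣ ≡ m
enlarge [] zero _ _ = [] , (λ x → x) , refl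
enlarge (inside ∷ T) (suc m) (s≤s ∣T∣≤m) (s≤s m≤K)
  with S , T⊆S , ∣S∣≡m ← enlarge T m ∣T∣≤m m≤K
  = inside ∷ S , (λ { here → here ; (there x) → there (T⊆S x) }) , cong suc ∣S∣≡m
enlarge {suc K} (outside ∷ T) m ∣T∣≤m m≤1+K with m ℕ.≤? K
-- room left in the tail: keep the head outside
... | yes m≤K with S , T⊆S , ∣S∣≡m ← enlarge T m ∣T∣≤m m≤K
  = outside ∷ S , (λ { (there x) → there (T⊆S x) }) , ∣S∣≡m
-- m = 1 + K: the full tail together with the head
... | no m≰K with S , T⊆S , ∣S∣≡K ← enlarge T K (∣p∣≤n T) ℕP.≤-refl
  = inside ∷ S , (λ { (there x) → there (T⊆S x) }) ,
    trans (cong suc ∣S∣≡K) (ℕP.≤-antisym (ℕP.≰⇒> m≰K) m≤1+K)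

residue : (K : ℕ) .{{_ : NonZero K}} → ℕ → Fin K
residue K i = fromℕ< (m%n<n i K)

residue-ModIs : (K : ℕ) .{{_ : NonZero K}} (i : ℕ) → ModIs K i (residue K i)
residue-ModIs K i = i / K , (begin
  i                                ≡⟨ m≡m%n+[m/n]*n i K ⟩
  i % K ℕ.+ i / K ℕ.* K            ≡⟨ ℕP.+-comm (i % K) _ ⟩
  i / K ℕ.* K ℕ.+ i % K            ≡⟨ cong (i / K ℕ.* K ℕ.+_) (≡-sym (FinP.toℕ-fromℕ< (m%n<n i K))) ⟩
  i / K ℕ.* K ℕ.+ toℕ (residue K i) ∎)
  where open ≡-Reasoning

no-loop : ∀ {n} (G : Graph n) {u v} → u ≡ v → Edge G u v → False
no-loop G {u} refl e with trans (≡-sym e) (irrefl G u)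
... | ()

module EdgeClasses {n : ℕ} (K : ℕ) .{{_ : NonZero K}}
                   (σ : Fin n → Fin n) (idx : Fin n → Fin n → ℕ) where

  edgeClass : Fin n → Fin n → Fin K
  edgeClass u v with FinP.<-cmp (σ u) (σ v)
  ... | tri< _ _ _ = residue K (idx u v ℕ.+ 1)
  ... | tri≈ _ _ _ = residue K 0
  ... | tri> _ _ _ = residue K (idx v u ℕ.+ 1)

  edgeClass-InClass : (G : Graph n) → (∀ {a b} → σ a ≡ σ b → a ≡ b) →
                      ∀ u v → Edge G u v → InClass K σ idx u v (edgeClass u v)
  edgeClass-InClass G σ-inj u v e with FinP.<-cmp (σ u) (σ v)
  ... | tri< σu<σv _ _ = inj₁ (σu<σv , residue-ModIs K _)
  ... | tri≈ _ σu≡σv _ = ⊥-elim (no-loop G (σ-inj σu≡σv) e)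
  ... | tri> _ _ σv<σu = inj₂ (σv<σu , residue-ModIs K _)

constant-on-connected : ∀ {c} {A : Set} (H : Graph c) → Connected H → (h : Fin c → A) →
                        (∀ i j → Edge H i j → h i ≡ h j) → ∀ i j → h i ≡ h j
constant-on-connected H conn h along i j = along-walk (conn i j)
  where
  along-walk : ∀ {i j} → Star (Edge H) i j → h i ≡ h j
  along-walk ε        = refl
  along-walk (e ◅ es) = trans (along _ _ e) (along-walk es)

record Layering {n} (G : Graph n) (G' : CopyGraph n) (L : Set) : Set where
  field
    layer      : V' G' → L
    adj-layer  : ∀ {x y} → adj' G' x y → layer x ≡ layer y
    adj-edge   : ∀ {x y} → adj' G' x y → Edge G (copy G' x) (copy G' y)
    copy-injective-on-layer :
      ∀ {x y} → layer x ≡ layer y → copy G' x ≡ copy G' y → x ≡ y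

-- An embedding of a connected H into a layered copy graph lies in one layer,
-- so its projection to G is again an embedding.
project-embedding : ∀ {c n L} {H : Graph c} {G : Graph n} {G' : CopyGraph n} →
                    Layering G G' L → Connected H →
                    (f' : Fin c → V' G') → IsEmbedding' H G' f' →
                    IsEmbedding H G (copy G' ∘ f')
project-embedding {H = H} lay conn f' (f'-inj , f'-edges) =
  (λ {i} {j} same-copy → f'-inj (copy-injective-on-layer (one-layer i j) same-copy)) ,
  (λ i j e → adj-edge (f'-edges i j e))
  where
  open Layering lay
  one-layer : ∀ i j → layer (f' i) ≡ layer (f' j)
  one-layer = constant-on-connected H conn (layer ∘ f') (λ i j e → adj-layer (f'-edges i j e))

ClassSet : (K m : ℕ) → Set
ClassSet K m = Σ (Subset K) (λ S → ∣ S ∣ ≡ m)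

ClassSet-≡ : ∀ {K m} (S T : ClassSet K m) → proj₁ S ≡ proj₁ T → S ≡ T
ClassSet-≡ (S , p) (.S , q) refl = cong (S ,_) (ℕP.≡-irrelevant p q)

-- One copy G_S of G for every S : ClassSet K m, keeping the edges of class in S
-- (this is construction3 when d > 4c², with K = 4c² and m = c²).
classCopies : ∀ {n} (K m : ℕ) → (Fin n → Fin n) → (Fin n → Fin n → ℕ) → Graph n → CopyGraph n
classCopies {n} K m σ idx G = record
  { V'   = ClassSet K m × Fin n
  ; adj' = λ { ((S , _) , v) ((S' , _) , w) →
               S ≡ S' × Edge G v w × (∃ λ p → p ∈ S × InClass K σ idx v w p) }
  ; copy = proj₂
  }

classCopies-Layering : ∀ {n} (K m : ℕ) (σ : Fin n → Fin n) (idx : Fin n → Fin n → ℕ)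
                       (G : Graph n) →
                       Layering G (classCopies K m σ idx G) (ClassSet K m)
classCopies-Layering K m σ idx G = record
  { layer     = proj₁
  ; adj-layer = λ {x} {y} adj → ClassSet-≡ (proj₁ x) (proj₁ y) (proj₁ adj)
  ; adj-edge  = λ adj → proj₁ (proj₂ adj)
  ; copy-injective-on-layer = λ { refl refl → refl }
  }

-- An embedding of H (c vertices) into G lifts into one copy G_S as soon as
-- c² ≤ m ≤ K: S is any m-set containing the classes of all pairs f i f j.
lift-embedding : ∀ {c n} (K m : ℕ) .{{_ : NonZero K}} → c ℕ.* c ≤ m → m ≤ K →
                 (H : Graph c) (G : Graph n) (σ : Fin n → Fin n) (idx : Fin n → Fin n → ℕ) →
                 (∀ {a b} → σ a ≡ σ b → a ≡ b) →
                 (f : Fin c → Fin n) → IsEmbedding H G f →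
                 Σ (Fin c → V' (classCopies K m σ idx G)) (λ f' →
                   IsEmbedding' H (classCopies K m σ idx G) f' × (∀ i → proj₂ (f' i) ≡ f i))
lift-embedding {c} {n} K m c²≤m m≤K H G σ idx σ-inj f (f-inj , f-edges) =
  f' , ((λ same → f-inj (cong proj₂ same)) , f'-edges) , λ i → refl
  where
  open EdgeClasses K σ idx
  pairClass : Fin c × Fin c → Fin K
  pairClass (i , j) = edgeClass (f i) (f j)
  used : Subset K
  used = image (c ℕ.* c) (pairClass ∘ remQuot c)
  pairClass∈used : ∀ i j → pairClass (i , j) ∈ used
  pairClass∈used i j = subst (_∈ used) (cong pairClass (FinP.remQuot-combine i j))
                             (∈image _ (pairClass ∘ remQuot c) (combine i j))
  chosen : ∃ λ T → used ⊆ T × ∣ T ∣ ≡ m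
  chosen = enlarge used m (ℕP.≤-trans (∣image∣≤ _ _) c²≤m) m≤K
  S : ClassSet K m
  S = proj₁ chosen , proj₂ (proj₂ chosen)
  f' : Fin c → ClassSet K m × Fin n
  f' i = S , f i
  f'-edges : ∀ i j → Edge H i j → adj' (classCopies K m σ idx G) (f' i) (f' j)
  f'-edges i j e = refl , f-edges i j e , pairClass (i , j) ,
                   proj₁ (proj₂ chosen) (pairClass∈used i j) ,
                   edgeClass-InClass G σ-inj (f i) (f j) (f-edges i j e)

-- Lemma 7: for d ≤ 4c² the construction returns G itself; otherwise it is
-- classCopies with K = 4c² classes and class sets of size m = c² (c ≥ 1 makes
-- K nonzero; only injectivity of σ is used from the ordering hypotheses).
lemma7 : ∀ {c n} (H : Graph c) → 1 < c → Connected H →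
         (G : Graph n) (d : ℕ) → IsDegeneracy G d →
         (σ : Fin n → Fin n) → IsDegeneracyOrdering G d σ →
         (idx : Fin n → Fin n → ℕ) → IsEnumeration G σ idx →
         ((f : Fin c → Fin n) → IsEmbedding H G f →
            Σ (Fin c → V' (construction3 c G d σ idx)) (λ f' →
              IsEmbedding' H (construction3 c G d σ idx) f' ×
              (∀ i → copy (construction3 c G d σ idx) (f' i) ≡ f i)))
         ×
         ((f' : Fin c → V' (construction3 c G d σ idx)) →
            IsEmbedding' H (construction3 c G d σ idx) f' →
            IsEmbedding H G (copy (construction3 c G d σ idx) ∘ f'))
lemma7 {c@(suc _)} H (s≤s _) conn G d _ σ (σ-inj , _) idx _ with d ℕ.≤? 4 ℕ.* c ℕ.* c
... | yes _ = (λ f emb → f , emb , λ i → refl) , (λ f' emb → emb)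
... | no _  =
  lift-embedding K (c ℕ.* c) ℕP.≤-refl c²≤K H G σ idx σ-inj ,
  project-embedding {H = H} (classCopies-Layering K (c ℕ.* c) σ idx G) conn
  where
  K = 4 ℕ.* c ℕ.* c
  c²≤K : c ℕ.* c ≤ K
  c²≤K = ℕP.*-monoˡ-≤ c (ℕP.m≤n*m c 4)
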